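{- For every integer $n\ge3$, the wheel graph $W_n$ satisfies \[\operatorname{gon}(W_n)=\lceil\sqrt n\rceil-1+\left\lceil\frac{n}{\lceil\sqrt n\rceil}\right\rceil.\]
   Context: The wheel graph $W_n$ ($n\ge3$) is the simple graph on $n+1$ vertices consisting of a cycle on $n$ vertices together with one additional vertex adjacent to every vertex of the cycle. A divisor on a graph is an integer combination $D=\sum_vD(v)(v)$ of vertices with degree $\sum_vD(v)$, effective if all $D(v)\ge0$. Divisors are equivalent if their difference is in the integer column space of the Laplacian matrix. The rank $r(D)$ is $-1$ if $D$ is not equivalent to an effective divisor, else the largest $r\ge0$ such that $D-E$ is equivalent to an effective divisor for every effective $E$ of degree $r$. The gonality $\operatorname{gon}(G)$ is the minimum degree of a divisor of positive rank. -}

module Defs where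

open import Data.Nat as ℕ using (ℕ; zero; suc; _/_)
open import Data.Integer as ℤ using (ℤ; +_; _-_; _*_; _+_; _≤_)
open import Data.Fin using (Fin; zero; suc; toℕ; _≟_)
open import Data.Product using (Σ; _×_; _,_)
open import Relation.Nullary using (does)
open import Relation.Binary.PropositionalEquality using (_≡_)
open import Data.Bool using (Bool; true; false; if_then_else_; _∨_)

Σℤ : (m : ℕ) → (Fin m → ℤ) → ℤ
Σℤ zero    f = + 0
Σℤ (suc m) f = f zero + Σℤ m (λ i → f (suc i))

-- A finite (multi)graph on vertex set Fin m given by its adjacency matrix
-- (number of edges between two vertices).  For simple graphs entries are 0/1
-- and the diagonal is 0.
record Graph : Set where
  field
    size : ℕ
    adj  : Fin size → Fin size → ℕ
open Graph public

Vertex : Graph → Set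
Vertex G = Fin (size G)

degV : (G : Graph) → Vertex G → ℤ
degV G v = Σℤ (size G) (λ w → + adj G v w)

laplacian : (G : Graph) → Vertex G → Vertex G → ℤ
laplacian G v w = (if does (v ≟ w) then degV G v else + 0) - + adj G v w

Divisor : Graph → Set
Divisor G = Vertex G → ℤ

deg : (G : Graph) → Divisor G → ℤ
deg G D = Σℤ (size G) D

Effective : (G : Graph) → Divisor G → Set
Effective G D = ∀ v → + 0 ≤ D v

subD : (G : Graph) → Divisor G → Divisor G → Divisor G
subD G D E v = D v - E v

Equiv : (G : Graph) → Divisor G → Divisor G → Set
Equiv G D D' = Σ (Vertex G → ℤ) λ z →
  ∀ v → D v - D' v ≡ Σℤ (size G) (λ w → laplacian G v w * z w)

EquivEffective : (G : Graph) → Divisor G → Set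
EquivEffective G D = Σ (Divisor G) λ D' → Effective G D' × Equiv G D D'

RankCondition : (G : Graph) → Divisor G → ℕ → Set
RankCondition G D r =
  (E : Divisor G) → Effective G E → deg G E ≡ + r → EquivEffective G (subD G D E)

-- r(D) ≥ 1 : the largest r satisfying the rank condition is at least 1
-- (equivalently, some r ≥ 1 satisfies it).
PositiveRank : (G : Graph) → Divisor G → Set
PositiveRank G D = Σ ℕ λ r → (1 ℕ.≤ r) × RankCondition G D r

IsGonality : Graph → ℤ → Set
IsGonality G k =
  (Σ (Divisor G) λ D → PositiveRank G D × deg G D ≡ k)
  × ((D : Divisor G) → PositiveRank G D → k ≤ deg G D)

cycAdj : (n : ℕ) → Fin n → Fin n → ℕ
cycAdj (suc k) i j =
  if (toℕ j ℕ.≡ᵇ (suc (toℕ i)) ℕ.% suc k) ∨ (toℕ i ℕ.≡ᵇ (suc (toℕ j)) ℕ.% suc k)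
  then 1 else 0

-- Wheel graph W_n on Fin (suc n): vertex zero is the hub, vertex suc i is the
-- i-th vertex of the n-cycle.
wheelAdj : (n : ℕ) → Fin (suc n) → Fin (suc n) → ℕ
wheelAdj n zero    zero    = 0
wheelAdj n zero    (suc j) = 1
wheelAdj n (suc i) zero    = 1
wheelAdj n (suc i) (suc j) = cycAdj n i j

wheel : ℕ → Graph
wheel n = record { size = suc n ; adj = wheelAdj n }

IsCeilSqrt : ℕ → ℕ → Set
IsCeilSqrt n s = n ℕ.≤ s ℕ.* s × (∀ t → n ℕ.≤ t ℕ.* t → s ℕ.≤ t)

-- ⌈n / (suc k)⌉
ceilDiv : ℕ → ℕ → ℕ
ceilDiv n k = (n ℕ.+ k) / suc k

-- Let s = k + 1 = ⌈√n⌉.  Upper bound: k chips on the hub and one chip on every rim vertex whose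
-- index is a multiple of s has degree k + ⌈n/s⌉ and rank one.  A chipless rim vertex lies in a
-- block of at most k consecutive rim vertices strictly between two multiples; pulling one chip
-- from the hub onto each block vertex is paid for by the hub and by the two chipped rim vertices
-- bordering the block.
-- Lower bound: for D of positive rank and a chipless rim vertex u of an effective representative,
-- fire the maximum level set U of a script moving a chip onto u (Dhar).  If the hub is outside U
-- the hub count grows, which can happen only finitely often; otherwise the hub holds a chip for
-- every rim vertex outside U, so some chip lies within D(hub) steps of u.  Hence every window of
-- a + 1 consecutive rim vertices (a = D(hub)) contains one of the c chipped rim vertices, so
-- n ≤ (a + 1)c, and AM–GM turns this into a + c ≥ k + ⌈n/s⌉.

module Submission where

open import Defs

open import Data.Bool using (Bool; true; false; if_then_else_; not; T)
open import Data.Bool.Properties using (∨-comm)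
open import Data.Empty using (⊥-elim)
open import Data.Fin using (Fin; zero; suc; toℕ; fromℕ<; _≟_)
import Data.Fin.Properties as FinP
open import Data.Integer as ℤ using (ℤ; +_; -_; _+_; _-_; _*_; _≤_; +≤+)
import Data.Integer.Properties as ℤP
open import Data.Integer.Tactic.RingSolver using (solve-∀)
import Data.Nat.Tactic.RingSolver as ℕRing
open import Data.Nat as ℕ using (ℕ; zero; suc; z≤n; s≤s; _%_; _/_; NonZero)
import Data.Nat.Properties as ℕP
open import Data.Nat.DivMod
open import Data.Nat.Divisibility using (n∣m*n)
open import Data.Product using (Σ; _×_; _,_)
open import Data.Sum using (_⊎_; inj₁; inj₂)
open import Function using (_∘_; case_of_)
open import Relation.Binary.PropositionalEquality
open import Relation.Nullary using (¬_; Dec; does; yes; no; _×-dec_)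
open import Relation.Nullary.Decidable using (dec-true; dec-false)
open import Algebra.Properties.Ring ℤP.+-*-ring using (x[y-z]≈xy-xz; [y-z]x≈yx-zx)

≡ᵇ⇒≡ : ∀ {a b} → (a ℕ.≡ᵇ b) ≡ true → a ≡ b
≡ᵇ⇒≡ {a} {b} eq = ℕP.≡ᵇ⇒≡ a b (subst T (sym eq) _)

indicator : Bool → ℤ
indicator true  = + 1
indicator false = + 0

indicator-nonNeg : ∀ b → + 0 ≤ indicator b
indicator-nonNeg true  = +≤+ z≤n
indicator-nonNeg false = ℤP.≤-refl

indicator≤1 : ∀ b → indicator b ≤ + 1
indicator≤1 true  = ℤP.≤-refl
indicator≤1 false = +≤+ z≤n

indicator-yes : ∀ {P : Set} (p? : Dec P) → P → indicator (does p?) ≡ + 1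
indicator-yes p? p = cong indicator (dec-true p? p)

indicator-no : ∀ {P : Set} (p? : Dec P) → ¬ P → indicator (does p?) ≡ + 0
indicator-no p? ¬p = cong indicator (dec-false p? ¬p)

<⇒1≤- : ∀ {i j} → i ℤ.< j → + 1 ≤ j - i
<⇒1≤- {i} {j} i<j = subst (_≤ j - i) (cancel i) (ℤP.+-monoˡ-≤ (- i) (ℤP.i<j⇒suc[i]≤j i<j))
  where
  cancel : ∀ i → + 1 + i - i ≡ + 1
  cancel = solve-∀

i≤+∣i∣ : ∀ i → i ≤ + ℤ.∣ i ∣
i≤+∣i∣ (+ n)      = ℤP.≤-refl
i≤+∣i∣ ℤ.-[1+ n ] = ℤ.-≤+

scale-mono-≤ : ∀ a {p q} → p ≤ q → + a * p ≤ + a * q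
scale-mono-≤ a = ℤP.*-monoˡ-≤-nonNeg (+ a)

scale-nonNeg : ∀ a {p} → + 0 ≤ p → + 0 ≤ + a * p
scale-nonNeg a {p} 0≤p = subst (_≤ + a * p) (ℤP.*-zeroʳ (+ a)) (scale-mono-≤ a 0≤p)

Σℤ-cong : ∀ m {f g : Fin m → ℤ} → (∀ i → f i ≡ g i) → Σℤ m f ≡ Σℤ m g
Σℤ-cong zero    f≗g = refl
Σℤ-cong (suc m) f≗g = cong₂ _+_ (f≗g zero) (Σℤ-cong m (f≗g ∘ suc))

Σℤ-distrib-+ : ∀ m (f g : Fin m → ℤ) → Σℤ m (λ i → f i + g i) ≡ Σℤ m f + Σℤ m g
Σℤ-distrib-+ zero    f g = refl
Σℤ-distrib-+ (suc m) f g
  rewrite Σℤ-distrib-+ m (f ∘ suc) (g ∘ suc) = swap (f zero) (g zero) _ _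
  where
  swap : ∀ a b c d → a + b + (c + d) ≡ a + c + (b + d)
  swap = solve-∀

Σℤ-neg : ∀ m (f : Fin m → ℤ) → Σℤ m (λ i → - f i) ≡ - Σℤ m f
Σℤ-neg zero    f = refl
Σℤ-neg (suc m) f rewrite Σℤ-neg m (f ∘ suc) = sym (ℤP.neg-distrib-+ (f zero) _)

Σℤ-distrib-- : ∀ m (f g : Fin m → ℤ) → Σℤ m (λ i → f i - g i) ≡ Σℤ m f - Σℤ m g
Σℤ-distrib-- m f g = trans (Σℤ-distrib-+ m f (λ i → - g i)) (cong (_+_ (Σℤ m f)) (Σℤ-neg m g))

Σℤ-const : ∀ m c → Σℤ m (λ _ → c) ≡ + m * c
Σℤ-const zero    c = sym (ℤP.*-zeroˡ c)
Σℤ-const (suc m) c = begin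
  c + Σℤ m (λ _ → c)  ≡⟨ cong (_+_ c) (Σℤ-const m c) ⟩
  c + + m * c         ≡⟨ cong (λ x → x + + m * c) (sym (ℤP.*-identityˡ c)) ⟩
  + 1 * c + + m * c   ≡⟨ sym (ℤP.*-distribʳ-+ c (+ 1) (+ m)) ⟩
  + suc m * c         ∎
  where open ≡-Reasoning

Σℤ-zero : ∀ m → Σℤ m (λ _ → + 0) ≡ + 0
Σℤ-zero m = trans (Σℤ-const m (+ 0)) (ℤP.*-zeroʳ (+ m))

Σℤ-*ˡ : ∀ m c (f : Fin m → ℤ) → Σℤ m (λ i → c * f i) ≡ c * Σℤ m f
Σℤ-*ˡ zero    c f = sym (ℤP.*-zeroʳ c)
Σℤ-*ˡ (suc m) c f rewrite Σℤ-*ˡ m c (f ∘ suc) = sym (ℤP.*-distribˡ-+ c (f zero) _)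

Σℤ-comm : ∀ m p (f : Fin m → Fin p → ℤ) →
  Σℤ m (λ i → Σℤ p (f i)) ≡ Σℤ p (λ j → Σℤ m (λ i → f i j))
Σℤ-comm zero    p f = sym (Σℤ-zero p)
Σℤ-comm (suc m) p f rewrite Σℤ-comm m p (f ∘ suc) =
  sym (Σℤ-distrib-+ p (f zero) (λ j → Σℤ m (λ i → f (suc i) j)))

Σℤ-mono-≤ : ∀ m {f g : Fin m → ℤ} → (∀ i → f i ≤ g i) → Σℤ m f ≤ Σℤ m g
Σℤ-mono-≤ zero    f≤g = ℤP.≤-refl
Σℤ-mono-≤ (suc m) f≤g = ℤP.+-mono-≤ (f≤g zero) (Σℤ-mono-≤ m (f≤g ∘ suc))

Σℤ-nonNeg : ∀ m {f : Fin m → ℤ} → (∀ i → + 0 ≤ f i) → + 0 ≤ Σℤ m f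
Σℤ-nonNeg m {f} 0≤f = subst (_≤ Σℤ m f) (Σℤ-zero m) (Σℤ-mono-≤ m 0≤f)

term≤Σℤ : ∀ m {f : Fin m → ℤ} → (∀ i → + 0 ≤ f i) → ∀ j → f j ≤ Σℤ m f
term≤Σℤ (suc m) {f} 0≤f zero = ℤP.i≤i+j (f zero) _ {{ℤ.nonNegative (Σℤ-nonNeg m (0≤f ∘ suc))}}
term≤Σℤ (suc m) {f} 0≤f (suc j) =
  ℤP.i≤j⇒i≤k+j (f zero) {{ℤ.nonNegative (0≤f zero)}} (term≤Σℤ m (0≤f ∘ suc) j)

Σℤ-select : ∀ m (v : Fin m) (f : Fin m → ℤ) →
  Σℤ m (λ w → if does (v ≟ w) then f w else + 0) ≡ f v
Σℤ-select (suc m) zero    f = trans (cong (_+_ (f zero)) (Σℤ-zero m)) (ℤP.+-identityʳ (f zero))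
Σℤ-select (suc m) (suc v) f = trans (ℤP.+-identityˡ _)
  (trans (Σℤ-cong m λ w → cong (λ b → if b then f (suc w) else + 0) (does-suc w))
         (Σℤ-select m v (f ∘ suc)))
  where
  does-suc : ∀ w → does (suc v ≟ suc w) ≡ does (v ≟ w)
  does-suc w with v ≟ w
  ... | yes _ = refl
  ... | no  _ = refl

Σ< : ℕ → (ℕ → ℤ) → ℤ
Σ< m g = Σℤ m (g ∘ toℕ)

Σ<-cong : ∀ m {f g : ℕ → ℤ} → (∀ i → i ℕ.< m → f i ≡ g i) → Σ< m f ≡ Σ< m g
Σ<-cong m f≗g = Σℤ-cong m (λ i → f≗g (toℕ i) (FinP.toℕ<n i))

Σ<-snoc : ∀ m g → Σ< (suc m) g ≡ Σ< m g + g m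
Σ<-snoc zero    g = trans (ℤP.+-identityʳ (g 0)) (sym (ℤP.+-identityˡ (g 0)))
Σ<-snoc (suc m) g rewrite Σ<-snoc m (g ∘ suc) = sym (ℤP.+-assoc (g 0) _ _)

Σ<-+ : ∀ a b g → Σ< (a ℕ.+ b) g ≡ Σ< a g + Σ< b (λ i → g (a ℕ.+ i))
Σ<-+ zero    b g = sym (ℤP.+-identityˡ _)
Σ<-+ (suc a) b g rewrite Σ<-+ a b (g ∘ suc) = sym (ℤP.+-assoc (g 0) _ _)

Σ<-rotate : ∀ m g → g m ≡ g 0 → Σ< m (g ∘ suc) ≡ Σ< m g
Σ<-rotate zero    g _      = refl
Σ<-rotate (suc m) g gm≡g0 = begin
  Σ< (suc m) (g ∘ suc)       ≡⟨ Σ<-snoc m (g ∘ suc) ⟩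
  Σ< m (g ∘ suc) + g (suc m) ≡⟨ ℤP.+-comm _ (g (suc m)) ⟩
  g (suc m) + Σ< m (g ∘ suc) ≡⟨ cong (λ x → x + Σ< m (g ∘ suc)) gm≡g0 ⟩
  Σ< (suc m) g               ∎
  where open ≡-Reasoning

Σ<-shift-periodic : ∀ m g → (∀ i → g (i ℕ.+ m) ≡ g i) →
  ∀ j → Σ< m (λ i → g (i ℕ.+ j)) ≡ Σ< m g
Σ<-shift-periodic m g periodic zero = Σℤ-cong m (λ i → cong g (ℕP.+-identityʳ (toℕ i)))
Σ<-shift-periodic m g periodic (suc j) = begin
  Σ< m (λ i → g (i ℕ.+ suc j))
    ≡⟨ Σℤ-cong m (λ i → cong g (ℕP.+-suc (toℕ i) j)) ⟩
  Σ< m (λ i → g (suc i ℕ.+ j))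
    ≡⟨ Σ<-rotate m (λ i → g (i ℕ.+ j)) (trans (cong g (ℕP.+-comm m j)) (periodic j)) ⟩
  Σ< m (λ i → g (i ℕ.+ j))
    ≡⟨ Σ<-shift-periodic m g periodic j ⟩
  Σ< m g ∎
  where open ≡-Reasoning

Σ<-mono-length : ∀ {j m} {g : ℕ → ℤ} → (∀ i → + 0 ≤ g i) → j ℕ.≤ m → Σ< j g ≤ Σ< m g
Σ<-mono-length {m = m} 0≤g z≤n       = Σℤ-nonNeg m (0≤g ∘ toℕ)
Σ<-mono-length {g = g} 0≤g (s≤s j≤m) = ℤP.+-monoʳ-≤ (g 0) (Σ<-mono-length (0≤g ∘ suc) j≤m)

term≤Σ< : ∀ {m} {g : ℕ → ℤ} → (∀ i → + 0 ≤ g i) → ∀ {j} → j ℕ.< m → g j ≤ Σ< m g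
term≤Σ< {m} {g} 0≤g j<m =
  subst (_≤ Σ< m g) (cong g (FinP.toℕ-fromℕ< j<m)) (term≤Σℤ m (0≤g ∘ toℕ) (fromℕ< j<m))

toℕ-mod : ∀ a n .{{_ : NonZero n}} → toℕ (a mod n) ≡ a % n
toℕ-mod a n = FinP.toℕ-fromℕ< (m%n<n a n)

toℕ-mod-< : ∀ {a n} .{{_ : NonZero n}} → a ℕ.< n → toℕ (a mod n) ≡ a
toℕ-mod-< {a} {n} a<n = trans (toℕ-mod a n) (m<n⇒m%n≡m a<n)

mod-cong : ∀ {a b n} .{{_ : NonZero n}} → a % n ≡ b % n → a mod n ≡ b mod n
mod-cong {a} {b} {n} eq = FinP.toℕ-injective (trans (toℕ-mod a n) (trans eq (sym (toℕ-mod b n))))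

toℕ-mod-id : ∀ {n} .{{_ : NonZero n}} (u : Fin n) → toℕ u mod n ≡ u
toℕ-mod-id u = FinP.toℕ-injective (toℕ-mod-< (FinP.toℕ<n u))

Σℤ-as-Σ< : ∀ n .{{_ : NonZero n}} (f : Fin n → ℤ) → Σℤ n f ≡ Σ< n (λ i → f (i mod n))
Σℤ-as-Σ< n f = Σℤ-cong n (λ u → cong f (sym (toℕ-mod-id u)))

Σℤ-rotate : ∀ n .{{_ : NonZero n}} (f : Fin n → ℤ) t → Σ< n (λ i → f ((i ℕ.+ t) mod n)) ≡ Σℤ n f
Σℤ-rotate n f t = trans (Σ<-shift-periodic n (λ i → f (i mod n)) periodic t) (sym (Σℤ-as-Σ< n f))
  where
  periodic : ∀ i → f ((i ℕ.+ n) mod n) ≡ f (i mod n)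
  periodic i = cong f (mod-cong ([m+n]%n≡m%n i n))

[m%n+k]%n≡[m+k]%n : ∀ m k n .{{_ : NonZero n}} → (m % n ℕ.+ k) % n ≡ (m ℕ.+ k) % n
[m%n+k]%n≡[m+k]%n m k n = begin
  (m % n ℕ.+ k) % n         ≡⟨ %-distribˡ-+ (m % n) k n ⟩
  (m % n % n ℕ.+ k % n) % n ≡⟨ cong (λ x → (x ℕ.+ k % n) % n) (m%n%n≡m%n m n) ⟩
  (m % n ℕ.+ k % n) % n     ≡⟨ sym (%-distribˡ-+ m k n) ⟩
  (m ℕ.+ k) % n             ∎
  where open ≡-Reasoning

toℕ-suc-mod : ∀ m n .{{_ : NonZero n}} → toℕ (suc m mod n) ≡ suc (toℕ (m mod n)) % n
toℕ-suc-mod m n = begin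
  toℕ (suc m mod n)           ≡⟨ toℕ-mod (suc m) n ⟩
  suc m % n                   ≡⟨ cong (_% n) (ℕP.+-comm 1 m) ⟩
  (m ℕ.+ 1) % n               ≡⟨ sym ([m%n+k]%n≡[m+k]%n m 1 n) ⟩
  (m % n ℕ.+ 1) % n           ≡⟨ cong (λ x → (x ℕ.+ 1) % n) (sym (toℕ-mod m n)) ⟩
  (toℕ (m mod n) ℕ.+ 1) % n   ≡⟨ cong (_% n) (ℕP.+-comm (toℕ (m mod n)) 1) ⟩
  suc (toℕ (m mod n)) % n     ∎
  where open ≡-Reasoning

LeastTrueBelow : (ℕ → Bool) → ℕ → Set
LeastTrueBelow f m = Σ ℕ λ j → j ℕ.< m × f j ≡ true × (∀ i → i ℕ.< j → f i ≡ false)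

search-least : ∀ f m → LeastTrueBelow f m ⊎ (∀ i → i ℕ.< m → f i ≡ false)
search-least f zero = inj₂ (λ i ())
search-least f (suc m) with search-least f m
... | inj₁ (j , j<m , fj , before) = inj₁ (j , ℕP.m≤n⇒m≤1+n j<m , fj , before)
... | inj₂ none with f m in fm
...   | true  = inj₁ (m , ℕP.≤-refl , fm , none)
...   | false = inj₂ λ i i<1+m → case ℕP.m≤n⇒m<n∨m≡n (ℕ.s≤s⁻¹ i<1+m) of λ
                  { (inj₁ i<m)  → none i i<m
                  ; (inj₂ refl) → fm }

all-or-some : ∀ m {A : Fin m → Set} {B : Set} → (∀ i → A i ⊎ B) → (∀ i → A i) ⊎ B
all-or-some zero    choice = inj₁ (λ ())
all-or-some (suc m) choice with choice zero | all-or-some m (choice ∘ suc)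
... | inj₂ b  | _        = inj₂ b
... | inj₁ _  | inj₂ b   = inj₂ b
... | inj₁ a₀ | inj₁ aₛ = inj₁ λ { zero → a₀ ; (suc i) → aₛ i }

argmax : ∀ m (f : Fin (suc m) → ℤ) → Σ (Fin (suc m)) λ i → ∀ j → f j ≤ f i
argmax zero    f = zero , λ { zero → ℤP.≤-refl }
argmax (suc m) f with argmax m (f ∘ suc)
... | i , fj≤fi with ℤP.≤-total (f zero) (f (suc i))
...   | inj₁ f0≤fi = suc i , λ { zero → f0≤fi ; (suc j) → fj≤fi j }
...   | inj₂ fi≤f0 = zero , λ { zero → ℤP.≤-refl ; (suc j) → ℤP.≤-trans (fj≤fi j) fi≤f0 }

-- Arithmetic of ⌈√N⌉

am-gm-small-factor : ∀ r x y K → x ℕ.≤ K → x ℕ.+ y ℕ.≤ K ℕ.+ K ℕ.+ r →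
  x ℕ.* y ℕ.≤ K ℕ.* (K ℕ.+ r)
am-gm-small-factor r x y K x≤K x+y≤ with ℕP.m≤n⇒∃[o]m+o≡n x≤K
... | e , refl = begin
  x ℕ.* y                                          ≤⟨ ℕP.*-monoʳ-≤ x y≤ ⟩
  x ℕ.* (x ℕ.+ 2 ℕ.* e ℕ.+ r)                     ≤⟨ ℕP.m≤m+n _ (e ℕ.* (e ℕ.+ r)) ⟩
  x ℕ.* (x ℕ.+ 2 ℕ.* e ℕ.+ r) ℕ.+ e ℕ.* (e ℕ.+ r) ≡⟨ expand x e r ⟩
  (x ℕ.+ e) ℕ.* (x ℕ.+ e ℕ.+ r)                   ∎
  where
  open ℕP.≤-Reasoning
  expand : ∀ x e r →
    x ℕ.* (x ℕ.+ 2 ℕ.* e ℕ.+ r) ℕ.+ e ℕ.* (e ℕ.+ r) ≡ (x ℕ.+ e) ℕ.* (x ℕ.+ e ℕ.+ r)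
  expand = ℕRing.solve-∀
  regroup : ∀ x e r → x ℕ.+ e ℕ.+ (x ℕ.+ e) ℕ.+ r ≡ x ℕ.+ (x ℕ.+ 2 ℕ.* e ℕ.+ r)
  regroup = ℕRing.solve-∀
  y≤ : y ℕ.≤ x ℕ.+ 2 ℕ.* e ℕ.+ r
  y≤ = ℕP.+-cancelˡ-≤ x y _ (ℕP.≤-trans x+y≤ (ℕP.≤-reflexive (regroup x e r)))

am-gm : ∀ r x y K → r ℕ.≤ 1 → x ℕ.+ y ℕ.≤ K ℕ.+ K ℕ.+ r → x ℕ.* y ℕ.≤ K ℕ.* (K ℕ.+ r)
am-gm r x y K r≤1 x+y≤ with x ℕ.≤? K
... | yes x≤K = am-gm-small-factor r x y K x≤K x+y≤
... | no  x≰K = subst (ℕ._≤ K ℕ.* (K ℕ.+ r)) (ℕP.*-comm y x)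
                  (am-gm-small-factor r y x K y≤K (subst (ℕ._≤ K ℕ.+ K ℕ.+ r) (ℕP.+-comm x y) x+y≤))
  where
  y≤K : y ℕ.≤ K
  y≤K = ℕP.+-cancelˡ-≤ (suc K) y K (begin
    suc K ℕ.+ y    ≤⟨ ℕP.+-monoˡ-≤ y (ℕP.≰⇒> x≰K) ⟩
    x ℕ.+ y        ≤⟨ x+y≤ ⟩
    K ℕ.+ K ℕ.+ r  ≤⟨ ℕP.+-monoʳ-≤ (K ℕ.+ K) r≤1 ⟩
    K ℕ.+ K ℕ.+ 1  ≡⟨ ℕP.+-comm (K ℕ.+ K) 1 ⟩
    suc K ℕ.+ K    ∎)
    where open ℕP.≤-Reasoning

ceilDiv≤ : ∀ {N k} r → N ℕ.≤ suc k ℕ.* (k ℕ.+ r) → ceilDiv N k ℕ.≤ k ℕ.+ r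
ceilDiv≤ {N} {k} r N≤ = ℕ.s≤s⁻¹ (m<n*o⇒m/o<n (begin-strict
  N ℕ.+ k                        ≤⟨ ℕP.+-monoˡ-≤ k N≤ ⟩
  suc k ℕ.* (k ℕ.+ r) ℕ.+ k      <⟨ ℕP.+-monoʳ-< (suc k ℕ.* (k ℕ.+ r)) (ℕP.n<1+n k) ⟩
  suc k ℕ.* (k ℕ.+ r) ℕ.+ suc k  ≡⟨ expand k r ⟩
  suc (k ℕ.+ r) ℕ.* suc k        ∎))
  where
  open ℕP.≤-Reasoning
  expand : ∀ k r → suc k ℕ.* (k ℕ.+ r) ℕ.+ suc k ≡ suc (k ℕ.+ r) ℕ.* suc k
  expand = ℕRing.solve-∀

am-gm-contrapositive : ∀ {N k a c} r → r ℕ.≤ 1 → k ℕ.* (k ℕ.+ r) ℕ.< N → N ℕ.≤ suc a ℕ.* c →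
  k ℕ.+ (k ℕ.+ r) ℕ.≤ a ℕ.+ c
am-gm-contrapositive {N} {k} {a} {c} r r≤1 k[k+r]<N N≤[1+a]c = ℕP.≮⇒≥ λ a+c<2k+r →
  ℕP.<⇒≱ k[k+r]<N (ℕP.≤-trans N≤[1+a]c (am-gm r (suc a) c k r≤1
    (subst (suc a ℕ.+ c ℕ.≤_) (sym (ℕP.+-assoc k k r)) a+c<2k+r)))

ceilSqrt-bracket : ∀ {N k} → IsCeilSqrt N (suc k) →
  Σ ℕ λ r → r ℕ.≤ 1 × k ℕ.* (k ℕ.+ r) ℕ.< N × N ℕ.≤ suc k ℕ.* (k ℕ.+ r)
ceilSqrt-bracket {N} {k} (N≤s² , s-least) with N ℕ.≤? suc k ℕ.* k
... | yes N≤sk = 0 , z≤n , subst (ℕ._< N) (cong (k ℕ.*_) (sym (ℕP.+-identityʳ k))) k²<N ,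
                 subst (N ℕ.≤_) (cong (suc k ℕ.*_) (sym (ℕP.+-identityʳ k))) N≤sk
  where
  k²<N : k ℕ.* k ℕ.< N
  k²<N = ℕP.≰⇒> (λ N≤k² → ℕP.1+n≰n (s-least k N≤k²))
... | no N≰sk = 1 , ℕP.≤-refl ,
                subst (ℕ._< N) (trans (ℕP.*-comm (suc k) k) (cong (k ℕ.*_) (ℕP.+-comm 1 k))) (ℕP.≰⇒> N≰sk) ,
                subst (N ℕ.≤_) (cong (suc k ℕ.*_) (ℕP.+-comm 1 k)) N≤s²

ceilSqrt-minimises : ∀ {N k a c} → IsCeilSqrt N (suc k) → N ℕ.≤ suc a ℕ.* c →
  k ℕ.+ ceilDiv N k ℕ.≤ a ℕ.+ c
ceilSqrt-minimises {N} {k} {a} {c} sqrt N≤[1+a]c =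
  let r , r≤1 , k[k+r]<N , N≤s[k+r] = ceilSqrt-bracket sqrt
  in ℕP.≤-trans (ℕP.+-monoʳ-≤ k (ceilDiv≤ {N} {k} r N≤s[k+r]))
                (am-gm-contrapositive {N} {k} {a} {c} r r≤1 k[k+r]<N N≤[1+a]c)

ceilSqrt-bounds : ∀ {N k} → 3 ℕ.≤ N → IsCeilSqrt N (suc k) → 1 ℕ.≤ k × suc k ℕ.< N
ceilSqrt-bounds {N} {zero} 3≤N (N≤1 , _) = ⊥-elim (ℕP.<⇒≱ (ℕP.<-≤-trans (s≤s (s≤s z≤n)) 3≤N) N≤1)
ceilSqrt-bounds {N} {suc zero} 3≤N _ = s≤s z≤n , 3≤N
ceilSqrt-bounds {N} {suc (suc j)} 3≤N (_ , s-least) = s≤s z≤n , ℕP.≤-<-trans k+1≤k² k²<N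
  where
  k²<N : suc (suc j) ℕ.* suc (suc j) ℕ.< N
  k²<N = ℕP.≰⇒> (λ N≤k² → ℕP.1+n≰n (s-least (suc (suc j)) N≤k²))
  expand : ∀ j → suc (suc j) ℕ.* suc (suc j) ≡ suc (suc (suc j)) ℕ.+ suc (3 ℕ.* j ℕ.+ j ℕ.* j)
  expand = ℕRing.solve-∀
  k+1≤k² : suc (suc (suc j)) ℕ.≤ suc (suc j) ℕ.* suc (suc j)
  k+1≤k² = subst (suc (suc (suc j)) ℕ.≤_) (sym (expand j)) (ℕP.m≤m+n _ _)

module _ (k : ℕ) where

  private
    s = suc k

  isMultiple : ℕ → ℤ
  isMultiple i = indicator (does (i % s ℕ.≟ 0))

  isMultiple-periodic : ∀ i → isMultiple (i ℕ.+ s) ≡ isMultiple i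
  isMultiple-periodic i = cong (λ r → indicator (does (r ℕ.≟ 0))) ([m+n]%n≡m%n i s)

  Σ<-isMultiple-gap : ∀ r → r ℕ.≤ k → Σ< r (isMultiple ∘ suc) ≡ + 0
  Σ<-isMultiple-gap r r≤k = trans (Σ<-cong r not-multiple) (Σℤ-zero r)
    where
    not-multiple : ∀ i → i ℕ.< r → isMultiple (suc i) ≡ + 0
    not-multiple i i<r = cong (λ x → indicator (does (x ℕ.≟ 0))) (m≤n⇒m%n≡m (ℕP.≤-trans i<r r≤k))

  Σ<-isMultiple-block : ∀ M → Σ< s (λ i → isMultiple (M ℕ.+ i)) ≡ + 1
  Σ<-isMultiple-block M = begin
    Σ< s (λ i → isMultiple (M ℕ.+ i))  ≡⟨ Σℤ-cong s (λ i → cong isMultiple (ℕP.+-comm M (toℕ i))) ⟩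
    Σ< s (λ i → isMultiple (i ℕ.+ M))  ≡⟨ Σ<-shift-periodic s isMultiple isMultiple-periodic M ⟩
    + 1 + Σ< k (isMultiple ∘ suc)      ≡⟨ cong (_+_ (+ 1)) (Σ<-isMultiple-gap k ℕP.≤-refl) ⟩
    + 1                                ∎
    where open ≡-Reasoning

  Σ<-isMultiple-blocks : ∀ r q → Σ< (r ℕ.+ q ℕ.* s) isMultiple ≡ Σ< r isMultiple + + q
  Σ<-isMultiple-blocks r zero = trans (cong (λ x → Σ< x isMultiple) (ℕP.+-identityʳ r)) (sym (ℤP.+-identityʳ _))
  Σ<-isMultiple-blocks r (suc q) = begin
    Σ< (r ℕ.+ suc q ℕ.* s) isMultiple
      ≡⟨ cong (λ x → Σ< x isMultiple)
              (trans (cong (r ℕ.+_) (ℕP.+-comm s (q ℕ.* s))) (sym (ℕP.+-assoc r (q ℕ.* s) s))) ⟩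
    Σ< (r ℕ.+ q ℕ.* s ℕ.+ s) isMultiple
      ≡⟨ Σ<-+ (r ℕ.+ q ℕ.* s) s isMultiple ⟩
    Σ< (r ℕ.+ q ℕ.* s) isMultiple + Σ< s (λ i → isMultiple (r ℕ.+ q ℕ.* s ℕ.+ i))
      ≡⟨ cong₂ _+_ (Σ<-isMultiple-blocks r q) (Σ<-isMultiple-block (r ℕ.+ q ℕ.* s)) ⟩
    Σ< r isMultiple + + q + + 1
      ≡⟨ trans (ℤP.+-assoc (Σ< r isMultiple) (+ q) (+ 1))
               (cong (λ x → Σ< r isMultiple + + x) (ℕP.+-comm q 1)) ⟩
    Σ< r isMultiple + + suc q ∎
    where open ≡-Reasoning

  Σ<-isMultiple-short : ∀ r → r ℕ.< s → Σ< r isMultiple ≡ + ceilDiv r k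
  Σ<-isMultiple-short zero    _         = cong +_ (sym (m<n⇒m/n≡0 (ℕP.n<1+n k)))
  Σ<-isMultiple-short (suc r) (s≤s r<k) =
    trans (cong (_+_ (+ 1)) (Σ<-isMultiple-gap r (ℕP.<⇒≤ r<k))) (cong +_ (sym ceilDiv≡1))
    where
    ceilDiv≡1 : (suc r ℕ.+ k) / s ≡ 1
    ceilDiv≡1 = trans (m/n≡1+[m∸n]/n (s≤s (ℕP.m≤n+m k r)))
      (cong suc (m<n⇒m/n≡0 (ℕP.≤-trans (s≤s (ℕP.≤-reflexive (ℕP.m+n∸n≡m r k))) (ℕP.<⇒≤ (s≤s r<k)))))

  ceilDiv-blocks : ∀ r q → ceilDiv (r ℕ.+ q ℕ.* s) k ≡ ceilDiv r k ℕ.+ q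
  ceilDiv-blocks r q = begin
    (r ℕ.+ q ℕ.* s ℕ.+ k) / s          ≡⟨ cong (_/ s) (swap r (q ℕ.* s) k) ⟩
    (r ℕ.+ k ℕ.+ q ℕ.* s) / s          ≡⟨ +-distrib-/-∣ʳ (r ℕ.+ k) (n∣m*n q) ⟩
    (r ℕ.+ k) / s ℕ.+ q ℕ.* s / s      ≡⟨ cong ((r ℕ.+ k) / s ℕ.+_) (m*n/n≡m q s) ⟩
    ceilDiv r k ℕ.+ q                  ∎
    where
    open ≡-Reasoning
    swap : ∀ a b c → a ℕ.+ b ℕ.+ c ≡ a ℕ.+ c ℕ.+ b
    swap = ℕRing.solve-∀

  Σ<-isMultiple : ∀ M → Σ< M isMultiple ≡ + ceilDiv M k
  Σ<-isMultiple M = begin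
    Σ< M isMultiple                            ≡⟨ cong (λ x → Σ< x isMultiple) M≡r+qs ⟩
    Σ< (M % s ℕ.+ M / s ℕ.* s) isMultiple     ≡⟨ Σ<-isMultiple-blocks (M % s) (M / s) ⟩
    Σ< (M % s) isMultiple + + (M / s)          ≡⟨ cong (_+ + (M / s)) (Σ<-isMultiple-short (M % s) (m%n<n M s)) ⟩
    + (ceilDiv (M % s) k ℕ.+ M / s)            ≡⟨ cong +_ (sym (ceilDiv-blocks (M % s) (M / s))) ⟩
    + ceilDiv (M % s ℕ.+ M / s ℕ.* s) k        ≡⟨ cong (λ x → + ceilDiv x k) (sym M≡r+qs) ⟩
    + ceilDiv M k                              ∎
    where
    open ≡-Reasoning
    M≡r+qs = m≡m%n+[m/n]*n M s

module _ (a k : ℕ) where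

  InBlock : ℕ → Set
  InBlock i = a ℕ.< i × i ℕ.< a ℕ.+ suc k

  inBlock? : ∀ i → Dec (InBlock i)
  inBlock? i = a ℕ.<? i ×-dec i ℕ.<? a ℕ.+ suc k

  inBlock : ℕ → ℤ
  inBlock i = indicator (does (inBlock? i))

  Σ<-inBlock-upto-end : Σ< (suc a ℕ.+ k) inBlock ≤ + k
  Σ<-inBlock-upto-end = begin
    Σ< (suc a ℕ.+ k) inBlock
      ≡⟨ Σ<-+ (suc a) k inBlock ⟩
    Σ< (suc a) inBlock + Σ< k (λ i → inBlock (suc a ℕ.+ i))
      ≡⟨ cong (_+ Σ< k (λ i → inBlock (suc a ℕ.+ i))) (trans (Σ<-cong (suc a) before-start) (Σℤ-zero (suc a))) ⟩
    + 0 + Σ< k (λ i → inBlock (suc a ℕ.+ i))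
      ≡⟨ ℤP.+-identityˡ _ ⟩
    Σ< k (λ i → inBlock (suc a ℕ.+ i))
      ≤⟨ Σℤ-mono-≤ k (λ i → indicator≤1 _) ⟩
    Σ< k (λ _ → + 1)
      ≡⟨ trans (Σℤ-const k (+ 1)) (ℤP.*-identityʳ (+ k)) ⟩
    + k ∎
    where
    open ℤP.≤-Reasoning
    before-start : ∀ i → i ℕ.< suc a → inBlock i ≡ + 0
    before-start i i≤a = indicator-no (inBlock? i) λ (a<i , _) → ℕP.<⇒≱ a<i (ℕ.s≤s⁻¹ i≤a)

  Σ<-inBlock≤ : ∀ M → Σ< M inBlock ≤ + k
  Σ<-inBlock≤ M with ℕP.≤-total M (suc a ℕ.+ k)
  ... | inj₁ M≤end =
    ℤP.≤-trans (Σ<-mono-length (indicator-nonNeg ∘ does ∘ inBlock?) M≤end) Σ<-inBlock-upto-end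
  ... | inj₂ end≤M with ℕP.m≤n⇒∃[o]m+o≡n end≤M
  ...   | e , refl = begin
    Σ< (suc a ℕ.+ k ℕ.+ e) inBlock
      ≡⟨ Σ<-+ (suc a ℕ.+ k) e inBlock ⟩
    Σ< (suc a ℕ.+ k) inBlock + Σ< e (λ i → inBlock (suc a ℕ.+ k ℕ.+ i))
      ≡⟨ cong (_+_ (Σ< (suc a ℕ.+ k) inBlock)) (trans (Σ<-cong e after-end) (Σℤ-zero e)) ⟩
    Σ< (suc a ℕ.+ k) inBlock + + 0
      ≡⟨ ℤP.+-identityʳ _ ⟩
    Σ< (suc a ℕ.+ k) inBlock
      ≤⟨ Σ<-inBlock-upto-end ⟩
    + k ∎
    where
    open ℤP.≤-Reasoning
    after-end : ∀ i → i ℕ.< e → inBlock (suc a ℕ.+ k ℕ.+ i) ≡ + 0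
    after-end i _ = indicator-no (inBlock? _) λ (_ , <end) →
      ℕP.<-irrefl refl (ℕP.<-≤-trans <end (ℕP.≤-trans (ℕP.≤-reflexive (ℕP.+-suc a k)) (ℕP.m≤m+n _ i)))

-- Laplacian, linear equivalence and rank one

module _ (G : Graph) where

  lap : (Vertex G → ℤ) → Vertex G → ℤ
  lap z v = Σℤ (size G) (λ w → laplacian G v w * z w)

  lap-flow : ∀ z v → lap z v ≡ Σℤ (size G) (λ w → + adj G v w * (z v - z w))
  lap-flow z v = begin
    Σℤ n (λ w → laplacian G v w * z w)
      ≡⟨ Σℤ-cong n split ⟩
    Σℤ n (λ w → (if does (v ≟ w) then degV G v * z w else + 0) - + adj G v w * z w)
      ≡⟨ Σℤ-distrib-- n _ _ ⟩
    Σℤ n (λ w → if does (v ≟ w) then degV G v * z w else + 0) - Σℤ n (λ w → + adj G v w * z w)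
      ≡⟨ cong (_- Σℤ n (λ w → + adj G v w * z w)) (trans (Σℤ-select n v _) degV*z) ⟩
    Σℤ n (λ w → + adj G v w * z v) - Σℤ n (λ w → + adj G v w * z w)
      ≡⟨ sym (Σℤ-distrib-- n _ _) ⟩
    Σℤ n (λ w → + adj G v w * z v - + adj G v w * z w)
      ≡⟨ Σℤ-cong n (λ w → sym (x[y-z]≈xy-xz (+ adj G v w) (z v) (z w))) ⟩
    Σℤ n (λ w → + adj G v w * (z v - z w)) ∎
    where
    open ≡-Reasoning
    n = size G
    split : ∀ w → laplacian G v w * z w ≡
      (if does (v ≟ w) then degV G v * z w else + 0) - + adj G v w * z w
    split w with does (v ≟ w)
    ... | true  = [y-z]x≈yx-zx (z w) (degV G v) (+ adj G v w)
    ... | false = [y-z]x≈yx-zx (z w) (+ 0) (+ adj G v w)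
    degV*z : degV G v * z v ≡ Σℤ n (λ w → + adj G v w * z v)
    degV*z = trans (ℤP.*-comm (degV G v) (z v))
      (trans (sym (Σℤ-*ˡ n (z v) (λ w → + adj G v w))) (Σℤ-cong n (λ w → ℤP.*-comm (z v) _)))

  lap-+ : ∀ z₁ z₂ v → lap (λ w → z₁ w + z₂ w) v ≡ lap z₁ v + lap z₂ v
  lap-+ z₁ z₂ v = trans (Σℤ-cong (size G) (λ w → ℤP.*-distribˡ-+ (laplacian G v w) (z₁ w) (z₂ w)))
                        (Σℤ-distrib-+ (size G) _ _)

  lap-neg : ∀ z v → lap (λ w → - z w) v ≡ - lap z v
  lap-neg z v = trans (Σℤ-cong (size G) (λ w → sym (ℤP.neg-distribʳ-* (laplacian G v w) (z w))))
                      (Σℤ-neg (size G) _)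

  lap-zero : ∀ v → lap (λ _ → + 0) v ≡ + 0
  lap-zero v = trans (Σℤ-cong (size G) (λ w → ℤP.*-zeroʳ (laplacian G v w))) (Σℤ-zero (size G))

  Equiv-refl : ∀ {D} → Equiv G D D
  Equiv-refl {D} = (λ _ → + 0) , λ v → trans (ℤP.+-inverseʳ (D v)) (sym (lap-zero v))

  Equiv-sym : ∀ {D D′} → Equiv G D D′ → Equiv G D′ D
  Equiv-sym {D} {D′} (z , D-D′≡Lz) = (λ w → - z w) , λ v →
    trans (flip (D v) (D′ v)) (trans (cong -_ (D-D′≡Lz v)) (sym (lap-neg z v)))
    where
    flip : ∀ a b → b - a ≡ - (a - b)
    flip = solve-∀

  Equiv-trans : ∀ {D D′ D″} → Equiv G D D′ → Equiv G D′ D″ → Equiv G D D″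
  Equiv-trans {D} {D′} {D″} (z₁ , eq₁) (z₂ , eq₂) = (λ w → z₁ w + z₂ w) , λ v →
    trans (sym (ℤP.+-minus-telescope (D v) (D′ v) (D″ v)))
          (trans (cong₂ _+_ (eq₁ v) (eq₂ v)) (sym (lap-+ z₁ z₂ v)))

  Equiv-subD : ∀ {D D′} E → Equiv G D D′ → Equiv G (subD G D E) (subD G D′ E)
  Equiv-subD {D} {D′} E (z , eq) = z , λ v → trans (cancel (D v) (D′ v) (E v)) (eq v)
    where
    cancel : ∀ a b c → a - c - (b - c) ≡ a - b
    cancel = solve-∀

  fire : Divisor G → (Vertex G → ℤ) → Divisor G
  fire D x v = D v - lap x v

  Equiv-fire : ∀ D x → Equiv G D (fire D x)
  Equiv-fire D x = x , λ v → cancel (D v) (lap x v)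
    where
    cancel : ∀ a l → a - (a - l) ≡ l
    cancel = solve-∀

  Symmetric : Set
  Symmetric = ∀ v w → adj G v w ≡ adj G w v

  Σ-lap≡0 : Symmetric → ∀ z → Σℤ (size G) (lap z) ≡ + 0
  Σ-lap≡0 adj-sym z = begin
    Σℤ n (lap z)
      ≡⟨ Σℤ-cong n (λ v → trans (lap-flow z v) (Σℤ-cong n (λ w → x[y-z]≈xy-xz (+ adj G v w) (z v) (z w)))) ⟩
    Σℤ n (λ v → Σℤ n (λ w → + adj G v w * z v - + adj G v w * z w))
      ≡⟨ Σℤ-cong n (λ v → Σℤ-distrib-- n _ _) ⟩
    Σℤ n (λ v → Σℤ n (λ w → + adj G v w * z v) - Σℤ n (λ w → + adj G v w * z w))
      ≡⟨ Σℤ-distrib-- n _ _ ⟩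
    X - Σℤ n (λ v → Σℤ n (λ w → + adj G v w * z w))
      ≡⟨ cong (_-_ X) (Σℤ-comm n n (λ v w → + adj G v w * z w)) ⟩
    X - Σℤ n (λ w → Σℤ n (λ v → + adj G v w * z w))
      ≡⟨ cong (_-_ X) (Σℤ-cong n (λ w → Σℤ-cong n (λ v → cong (λ a → + a * z w) (adj-sym v w)))) ⟩
    X - X
      ≡⟨ ℤP.+-inverseʳ X ⟩
    + 0 ∎
    where
    open ≡-Reasoning
    n = size G
    X = Σℤ n (λ v → Σℤ n (λ w → + adj G v w * z v))

  deg-Equiv : Symmetric → ∀ {D D′} → Equiv G D D′ → deg G D ≡ deg G D′
  deg-Equiv adj-sym {D} {D′} (z , eq) = ℤP.i-j≡0⇒i≡j _ _
    (trans (sym (Σℤ-distrib-- (size G) D D′)) (trans (Σℤ-cong (size G) eq) (Σ-lap≡0 adj-sym z)))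

  point : Vertex G → ℕ → Divisor G
  point v r w = if does (v ≟ w) then + r else + 0

  point-nonNeg : ∀ v r → Effective G (point v r)
  point-nonNeg v r w with does (v ≟ w)
  ... | true  = +≤+ z≤n
  ... | false = ℤP.≤-refl

  point-self : ∀ v r → point v r v ≡ + r
  point-self v r with v ≟ v
  ... | yes _  = refl
  ... | no v≢v = ⊥-elim (v≢v refl)

  deg-point : ∀ v r → deg G (point v r) ≡ + r
  deg-point v r = Σℤ-select (size G) v (λ _ → + r)

  subD-point-effective : ∀ {D} v → Effective G D → + 1 ≤ D v → Effective G (subD G D (point v 1))
  subD-point-effective {D} v D≥0 1≤Dv w with v ≟ w
  ... | yes refl = ℤP.i≤j⇒0≤j-i 1≤Dv
  ... | no  _    = subst (+ 0 ≤_) (sym (ℤP.+-identityʳ (D w))) (D≥0 w)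

  effective-deg1⇒point : ∀ E → Effective G E → deg G E ≡ + 1 →
    Σ (Vertex G) λ v → ∀ w → E w ≡ point v 1 w
  effective-deg1⇒point E E≥0 degE≡1 with FinP.all? (λ w → E w ℤ.≤? + 0)
  ... | yes E≤0 = ⊥-elim (ℤP.<⇒≱ (ℤ.+<+ (s≤s z≤n))
                    (subst₂ _≤_ degE≡1 (Σℤ-zero (size G)) (Σℤ-mono-≤ (size G) E≤0)))
  ... | no ¬E≤0 with FinP.¬∀⟶∃¬ (size G) _ (λ w → E w ℤ.≤? + 0) ¬E≤0
  ...   | v , Ev≰0 = v , E≡point
    where
    rest : Divisor G
    rest = subD G E (point v 1)
    rest≥0 : Effective G rest
    rest≥0 = subD-point-effective v E≥0 (ℤP.i<j⇒suc[i]≤j (ℤP.≰⇒> Ev≰0))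
    Σrest≡0 : Σℤ (size G) rest ≡ + 0
    Σrest≡0 = trans (Σℤ-distrib-- (size G) E (point v 1)) (cong₂ _-_ degE≡1 (deg-point v 1))
    E≡point : ∀ w → E w ≡ point v 1 w
    E≡point w = ℤP.i-j≡0⇒i≡j _ _
      (ℤP.≤-antisym (subst (rest w ≤_) Σrest≡0 (term≤Σℤ (size G) rest≥0 w)) (rest≥0 w))

  RankOne : Divisor G → Set
  RankOne D = ∀ v → EquivEffective G (subD G D (point v 1))

  PositiveRank⇒RankOne : ∀ {D} → PositiveRank G D → RankOne D
  PositiveRank⇒RankOne {D} (r , 1≤r , rank-r) v
    with rank-r (point v r) (point-nonNeg v r) (deg-point v r)
  ... | F , F≥0 , (z , eq) = (λ w → F w + extra w) , (λ w → ℤP.+-mono-≤ (F≥0 w) (extra≥0 w)) ,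
                             (z , λ w → trans (regroup (D w) (point v 1 w) (F w) (point v r w)) (eq w))
    where
    extra : Divisor G
    extra w = point v r w - point v 1 w
    extra≥0 : Effective G extra
    extra≥0 w with does (v ≟ w)
    ... | true  = ℤP.i≤j⇒0≤j-i (+≤+ 1≤r)
    ... | false = ℤP.≤-refl
    regroup : ∀ d e f g → d - e - (f + (g - e)) ≡ d - g - f
    regroup = solve-∀

  RankOne⇒PositiveRank : ∀ {D} → RankOne D → PositiveRank G D
  RankOne⇒PositiveRank {D} rank1 = 1 , ℕP.≤-refl , λ E E≥0 degE≡1 →
    let v , E≡point = effective-deg1⇒point E E≥0 degE≡1
        F , F≥0 , (z , eq) = rank1 v
    in F , F≥0 , z , λ w → trans (cong (λ e → D w - e - F w) (E≡point w)) (eq w)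

  RankOne-Equiv : ∀ {D D′} → Equiv G D D′ → RankOne D → RankOne D′
  RankOne-Equiv {D} {D′} D~D′ rank1 v =
    let F , F≥0 , D-v~F = rank1 v
    in F , F≥0 , Equiv-trans {subD G D′ (point v 1)} {subD G D (point v 1)}
                      (Equiv-subD {D′} {D} (point v 1) (Equiv-sym {D} {D′} D~D′)) D-v~F

  RankOne⇒chipAt : ∀ {D} → RankOne D → ∀ v →
    Σ (Divisor G) λ D′ → Effective G D′ × (+ 1 ≤ D′ v) × Equiv G D D′
  RankOne⇒chipAt {D} rank1 v with rank1 v
  ... | F , F≥0 , (z , eq) =
    (λ w → F w + point v 1 w) ,
    (λ w → ℤP.+-mono-≤ (F≥0 w) (point-nonNeg v 1 w)) ,
    subst (λ c → + 1 ≤ F v + c) (sym (point-self v 1)) (ℤP.i≤j+i (+ 1) (F v) {{ℤ.nonNegative (F≥0 v)}}) ,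
    (z , λ w → trans (regroup (D w) (F w) (point v 1 w)) (eq w))
    where
    regroup : ∀ d f e → d - (f + e) ≡ d - e - f
    regroup = solve-∀

-- Dhar's argument: if D − D′ = L z with D′ effective, firing the set U where z is maximal is
-- legal from any effective D, and no vertex of U can gain chips from D to D′.
module MaxLevelSet (G : Graph) (z : Vertex G → ℤ) (m : Vertex G) (z≤zm : ∀ w → z w ≤ z m) where

  inU : Vertex G → Bool
  inU w = does (z w ℤ.≟ z m)

  𝟙U : Vertex G → ℤ
  𝟙U = indicator ∘ inU

  inU-true : ∀ {w} → inU w ≡ true → z w ≡ z m
  inU-true {w} w∈U with z w ℤ.≟ z m
  ... | yes zw≡zm = zw≡zm

  inU-false : ∀ {w} → inU w ≡ false → + 1 ≤ z m - z w
  inU-false {w} w∉U with z w ℤ.≟ z m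
  ... | no zw≢zm = <⇒1≤- (ℤP.≤∧≢⇒< (z≤zm w) zw≢zm)

  m∈U : inU m ≡ true
  m∈U with z m ℤ.≟ z m
  ... | yes _     = refl
  ... | no zm≢zm = ⊥-elim (zm≢zm refl)

  lap-𝟙U≤lap-z : ∀ {w} → inU w ≡ true → lap G 𝟙U w ≤ lap G z w
  lap-𝟙U≤lap-z {w} w∈U = subst₂ _≤_ (sym (lap-flow G 𝟙U w)) (sym (lap-flow G z w))
    (Σℤ-mono-≤ (size G) (λ y → scale-mono-≤ (adj G w y) (step y)))
    where
    step : ∀ y → 𝟙U w - 𝟙U y ≤ z w - z y
    step y rewrite w∈U | inU-true w∈U with inU y in y∈U
    ... | true  rewrite inU-true y∈U = ℤP.≤-reflexive (trans (ℤP.+-inverseʳ (+ 1)) (sym (ℤP.+-inverseʳ (z m))))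
    ... | false = inU-false y∈U

  lap-𝟙U≤0 : ∀ {w} → inU w ≡ false → lap G 𝟙U w ≤ + 0
  lap-𝟙U≤0 {w} w∉U = subst₂ _≤_ (sym (lap-flow G 𝟙U w)) (Σℤ-zero (size G))
    (Σℤ-mono-≤ (size G) (λ y → subst (+ adj G w y * (𝟙U w - 𝟙U y) ≤_) (ℤP.*-zeroʳ (+ adj G w y))
                                 (scale-mono-≤ (adj G w y) (step y))))
    where
    step : ∀ y → 𝟙U w - 𝟙U y ≤ + 0
    step y rewrite w∉U = subst (_≤ + 0) (sym (ℤP.+-identityˡ _)) (ℤP.neg-mono-≤ (indicator-nonNeg (inU y)))

  lap-z-nonNeg-on-U : ∀ {w} → inU w ≡ true → + 0 ≤ lap G z w
  lap-z-nonNeg-on-U {w} w∈U = subst (+ 0 ≤_) (sym (lap-flow G z w))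
    (Σℤ-nonNeg (size G) (λ y → scale-nonNeg (adj G w y)
      (ℤP.i≤j⇒0≤j-i (subst (z y ≤_) (sym (inU-true w∈U)) (z≤zm y)))))

  module _ (D D′ : Divisor G) (D′≥0 : Effective G D′) (D-D′≡Lz : ∀ v → D v - D′ v ≡ lap G z v) where

    lap-z≤D : ∀ w → lap G z w ≤ D w
    lap-z≤D w = subst (_≤ D w) (D-D′≡Lz w) (ℤP.i-j≤i (D w) (D′ w) {{ℤ.nonNegative (D′≥0 w)}})

    fire-U-effective : Effective G D → Effective G (fire G D 𝟙U)
    fire-U-effective D≥0 w with inU w in w∈U
    ... | true  = ℤP.i≤j⇒0≤j-i (ℤP.≤-trans (lap-𝟙U≤lap-z w∈U) (lap-z≤D w))
    ... | false = ℤP.≤-trans (D≥0 w) (ℤP.i≤i+j (D w) _ {{ℤ.nonNegative (ℤP.neg-mono-≤ (lap-𝟙U≤0 w∈U))}})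

    gain⇒∉U : ∀ c → D c ≤ + 0 → + 1 ≤ D′ c → inU c ≡ false
    gain⇒∉U c Dc≤0 1≤D′c with inU c in c∈U
    ... | false = refl
    ... | true  = ⊥-elim (ℤP.<⇒≱ ℤ.-<+ (ℤP.≤-trans (lap-z-nonNeg-on-U c∈U) Lz≤-1))
      where
      Lz≤-1 : lap G z c ≤ - + 1
      Lz≤-1 = subst (_≤ - + 1) (D-D′≡Lz c) (ℤP.+-mono-≤ Dc≤0 (ℤP.neg-mono-≤ 1≤D′c))

-- The wheel

module _ (n : ℕ) where

  wheel-symmetric : Symmetric (wheel n)
  wheel-symmetric zero    zero    = refl
  wheel-symmetric zero    (suc w) = refl
  wheel-symmetric (suc v) zero    = refl
  wheel-symmetric (suc v) (suc w) = cycAdj-sym n v w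
    where
    cycAdj-sym : ∀ n (i j : Fin n) → cycAdj n i j ≡ cycAdj n j i
    cycAdj-sym (suc k) i j = cong (λ b → if b then 1 else 0) (∨-comm (toℕ j ℕ.≡ᵇ suc (toℕ i) % suc k) _)

  lap-hub : ∀ z → lap (wheel n) z zero ≡ Σℤ n (λ i → z zero - z (suc i))
  lap-hub z = trans (lap-flow (wheel n) z zero) (trans (ℤP.+-identityˡ _) (Σℤ-cong n (λ i → ℤP.*-identityˡ _)))

  lap-rim : ∀ z u → lap (wheel n) z (suc u) ≡
    (z (suc u) - z zero) + Σℤ n (λ w → + cycAdj n u w * (z (suc u) - z (suc w)))
  lap-rim z u = trans (lap-flow (wheel n) z (suc u))
    (cong (_+ Σℤ n (λ w → + cycAdj n u w * (z (suc u) - z (suc w)))) (ℤP.*-identityˡ (z (suc u) - z zero)))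

module _ {n′ : ℕ} where

  private
    N = suc n′

  next : Fin N → Fin N
  next u = suc (toℕ u) mod N

  prev : Fin N → Fin N
  prev u = (toℕ u ℕ.+ n′) mod N

  next-unique : ∀ u w → toℕ w ≡ suc (toℕ u) % N → next u ≡ w
  next-unique u w eq = FinP.toℕ-injective (trans (toℕ-mod (suc (toℕ u)) N) (sym eq))

  prev-unique : ∀ u w → toℕ u ≡ suc (toℕ w) % N → prev u ≡ w
  prev-unique u w eq = FinP.toℕ-injective (begin
    toℕ (prev u)                   ≡⟨ toℕ-mod (toℕ u ℕ.+ n′) N ⟩
    (toℕ u ℕ.+ n′) % N             ≡⟨ cong (λ x → (x ℕ.+ n′) % N) eq ⟩
    (suc (toℕ w) % N ℕ.+ n′) % N   ≡⟨ [m%n+k]%n≡[m+k]%n (suc (toℕ w)) n′ N ⟩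
    (suc (toℕ w) ℕ.+ n′) % N       ≡⟨ cong (_% N) (sym (ℕP.+-suc (toℕ w) n′)) ⟩
    (toℕ w ℕ.+ N) % N              ≡⟨ [m+n]%n≡m%n (toℕ w) N ⟩
    toℕ w % N                      ≡⟨ m<n⇒m%n≡m (FinP.toℕ<n w) ⟩
    toℕ w                          ∎)
    where open ≡-Reasoning

  cycAdj-succ : ∀ p q → toℕ p ≡ suc (toℕ q) % N → cycAdj N p q ≡ 1
  cycAdj-succ p q eq with toℕ q ℕ.≡ᵇ suc (toℕ p) % N
  ... | true  = refl
  ... | false with toℕ p ℕ.≡ᵇ suc (toℕ q) % N in ne
  ...   | true  = refl
  ...   | false = ⊥-elim (subst T ne (ℕP.≡⇒≡ᵇ _ _ eq))

  Σ-cycle-neighbours≤ : ∀ u (f : Fin N → ℤ) → (∀ w → + 0 ≤ f w) →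
    Σℤ N (λ w → + cycAdj N u w * f w) ≤ f (next u) + f (prev u)
  Σ-cycle-neighbours≤ u f f≥0 = ℤP.≤-trans (Σℤ-mono-≤ N termwise) (ℤP.≤-reflexive
    (trans (Σℤ-distrib-+ N (select (next u)) (select (prev u)))
           (cong₂ _+_ (Σℤ-select N (next u) f) (Σℤ-select N (prev u) f))))
    where
    select : Fin N → Fin N → ℤ
    select a w = if does (a ≟ w) then f w else + 0
    select-nonNeg : ∀ a w → + 0 ≤ select a w
    select-nonNeg a w with does (a ≟ w)
    ... | true  = f≥0 w
    ... | false = ℤP.≤-refl
    select-self : ∀ a w → a ≡ w → select a w ≡ f w
    select-self a w a≡w with a ≟ w
    ... | yes _   = refl
    ... | no a≢w = ⊥-elim (a≢w a≡w)
    termwise : ∀ w → + cycAdj N u w * f w ≤ select (next u) w + select (prev u) w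
    termwise w with toℕ w ℕ.≡ᵇ suc (toℕ u) % N in w-follows
    ... | true  = subst₂ _≤_ (sym (ℤP.*-identityˡ (f w))) (cong (_+ select (prev u) w)
                    (sym (select-self (next u) w (next-unique u w (≡ᵇ⇒≡ w-follows)))))
                    (ℤP.i≤i+j (f w) _ {{ℤ.nonNegative (select-nonNeg (prev u) w)}})
    ... | false with toℕ u ℕ.≡ᵇ suc (toℕ w) % N in u-follows
    ...   | true  = subst₂ _≤_ (sym (ℤP.*-identityˡ (f w))) (cong (_+_ (select (next u) w))
                      (sym (select-self (prev u) w (prev-unique u w (≡ᵇ⇒≡ u-follows)))))
                      (ℤP.i≤j+i (f w) _ {{ℤ.nonNegative (select-nonNeg (next u) w)}})
    ...   | false = ℤP.+-mono-≤ (select-nonNeg (next u) w) (select-nonNeg (prev u) w)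

  toℕ-next : ∀ p → toℕ (next p) ≡ 0 ⊎ toℕ (next p) ≡ suc (toℕ p)
  toℕ-next p with ℕP.m≤n⇒m<n∨m≡n (FinP.toℕ<n p)
  ... | inj₁ p+1<N  = inj₂ (toℕ-mod-< p+1<N)
  ... | inj₂ p+1≡N = inj₁ (trans (toℕ-mod (suc (toℕ p)) N) (trans (cong (_% N) p+1≡N) (n%n≡0 N)))

  toℕ-prev : ∀ p → (toℕ p ≡ 0 × toℕ (prev p) ≡ n′) ⊎ toℕ p ≡ suc (toℕ (prev p))
  toℕ-prev p with toℕ p in p≡
  ... | zero  = inj₁ (refl , toℕ-mod-< (ℕP.n<1+n n′))
  ... | suc P = inj₂ (cong suc (sym (begin
    toℕ ((suc P ℕ.+ n′) mod N) ≡⟨ toℕ-mod (suc P ℕ.+ n′) N ⟩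
    (suc P ℕ.+ n′) % N        ≡⟨ cong (_% N) (sym (ℕP.+-suc P n′)) ⟩
    (P ℕ.+ N) % N             ≡⟨ [m+n]%n≡m%n P N ⟩
    P % N                     ≡⟨ m<n⇒m%n≡m (ℕP.<-trans (ℕP.n<1+n P) (subst (ℕ._< N) p≡ (FinP.toℕ<n p))) ⟩
    P                         ∎)))
    where open ≡-Reasoning

-- Upper bound

module _ (n′ k : ℕ) (s<N : suc k ℕ.< suc n′) where

  private
    N = suc n′
    W = wheel N
    s = suc k

  multiplesDivisor : Divisor W
  multiplesDivisor zero    = + k
  multiplesDivisor (suc u) = isMultiple k (toℕ u)

  multiplesDivisor-effective : Effective W multiplesDivisor
  multiplesDivisor-effective zero    = +≤+ z≤n
  multiplesDivisor-effective (suc u) = indicator-nonNeg _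

  deg-multiplesDivisor : deg W multiplesDivisor ≡ + (k ℕ.+ ceilDiv N k)
  deg-multiplesDivisor = cong (_+_ (+ k)) (Σ<-isMultiple k N)

  module _ (u : Fin N) (u-not-multiple : toℕ u % s ≢ 0) where

    private
      a = toℕ u / s ℕ.* s
      InB = InBlock a k

    a-multiple : a % s ≡ 0
    a-multiple = m*n%n≡0 (toℕ u / s) s

    u∈block : InB (toℕ u)
    u∈block = subst (a ℕ.<_) (sym u≡r+a) (ℕP.m<n+m a (ℕP.n≢0⇒n>0 u-not-multiple)) ,
              subst (ℕ._< a ℕ.+ s) (sym u≡r+a) (subst (toℕ u % s ℕ.+ a ℕ.<_) (ℕP.+-comm s a)
                                                  (ℕP.+-monoˡ-< a (m%n<n (toℕ u) s)))
      where
      u≡r+a : toℕ u ≡ toℕ u % s ℕ.+ a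
      u≡r+a = m≡m%n+[m/n]*n (toℕ u) s

    block : Vertex W → ℤ
    block zero    = + 0
    block (suc w) = inBlock a k (toℕ w)

    entering-block-at-start : ∀ (p : Fin N) → InB (toℕ (next p)) → ¬ InB (toℕ p) → toℕ p ≡ a
    entering-block-at-start p (a<next , next<end) p∉B with toℕ-next p
    ... | inj₁ next≡0 = ⊥-elim (ℕP.n≮0 (subst (a ℕ.<_) next≡0 a<next))
    ... | inj₂ next≡p+1 = ℕP.≤-antisym (ℕP.≮⇒≥ λ a<p → p∉B (a<p , ℕP.<-trans (ℕP.n<1+n (toℕ p)) p+1<end))
                                        (ℕ.s≤s⁻¹ (subst (a ℕ.<_) next≡p+1 a<next))
      where
      p+1<end : suc (toℕ p) ℕ.< a ℕ.+ s
      p+1<end = subst (ℕ._< a ℕ.+ s) next≡p+1 next<end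

    leaving-block-at-multiple : ∀ (p : Fin N) → InB (toℕ (prev p)) → ¬ InB (toℕ p) → toℕ p % s ≡ 0
    leaving-block-at-multiple p (a<prev , prev<end) p∉B with toℕ-prev p
    ... | inj₁ (p≡0 , _) = cong (_% s) p≡0
    ... | inj₂ p≡prev+1 = trans (cong (_% s) p≡a+s) (trans ([m+n]%n≡m%n a s) a-multiple)
      where
      a<p : a ℕ.< toℕ p
      a<p = subst (a ℕ.<_) (sym p≡prev+1) (ℕP.m<n⇒m<1+n a<prev)
      p≡a+s : toℕ p ≡ a ℕ.+ s
      p≡a+s = ℕP.≤-antisym (subst (ℕ._≤ a ℕ.+ s) (sym p≡prev+1) prev<end)
                            (ℕP.≮⇒≥ λ p<end → p∉B (a<p , p<end))

    entering-block⇒prev∉block : ∀ (p : Fin N) → InB (toℕ (next p)) → ¬ InB (toℕ p) → ¬ InB (toℕ (prev p))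
    entering-block⇒prev∉block p next∈B p∉B (a<prev , prev<end) with toℕ-prev p
    ... | inj₁ (p≡0 , prev≡n′) = ℕP.<⇒≱ s<N (subst₂ (λ x y → x ℕ.< y ℕ.+ s) prev≡n′ a≡0 prev<end)
      where
      a≡0 : a ≡ 0
      a≡0 = trans (sym (entering-block-at-start p next∈B p∉B)) p≡0
    ... | inj₂ p≡prev+1 = ℕP.<-asym a<prev (subst (toℕ (prev p) ℕ.<_) (entering-block-at-start p next∈B p∉B)
                            (subst (toℕ (prev p) ℕ.<_) (sym p≡prev+1) (ℕP.n<1+n _)))

    block-rim-∈ : ∀ {w} → InB (toℕ w) → block (suc w) ≡ + 1
    block-rim-∈ {w} = indicator-yes (inBlock? a k (toℕ w))

    block-rim-∉ : ∀ {w} → ¬ InB (toℕ w) → block (suc w) ≡ + 0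
    block-rim-∉ {w} = indicator-no (inBlock? a k (toℕ w))

    block-neighbours≤ : ∀ (p : Fin N) → ¬ InB (toℕ p) →
      block (suc (next p)) + block (suc (prev p)) ≤ isMultiple k (toℕ p)
    block-neighbours≤ p p∉B = by-cases (inBlock? a k (toℕ (next p))) (inBlock? a k (toℕ (prev p)))
      where
      multiple : toℕ p % s ≡ 0 → isMultiple k (toℕ p) ≡ + 1
      multiple = indicator-yes (toℕ p % s ℕ.≟ 0)
      by-cases : Dec (InB (toℕ (next p))) → Dec (InB (toℕ (prev p))) →
        block (suc (next p)) + block (suc (prev p)) ≤ isMultiple k (toℕ p)
      by-cases (yes next∈B) (yes prev∈B) = ⊥-elim (entering-block⇒prev∉block p next∈B p∉B prev∈B)
      by-cases (yes next∈B) (no  prev∉B) = ℤP.≤-reflexive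
        (trans (cong₂ _+_ (block-rim-∈ next∈B) (block-rim-∉ prev∉B))
               (sym (multiple (trans (cong (_% s) (entering-block-at-start p next∈B p∉B)) a-multiple))))
      by-cases (no  next∉B) (yes prev∈B) = ℤP.≤-reflexive
        (trans (cong₂ _+_ (block-rim-∉ next∉B) (block-rim-∈ prev∈B))
               (sym (multiple (leaving-block-at-multiple p prev∈B p∉B))))
      by-cases (no  next∉B) (no  prev∉B) = subst (_≤ isMultiple k (toℕ p))
        (sym (cong₂ _+_ (block-rim-∉ next∉B) (block-rim-∉ prev∉B))) (indicator-nonNeg _)

    lap-block-hub : lap W block zero ≡ - Σ< N (inBlock a k)
    lap-block-hub = trans (lap-hub N block)
      (trans (Σℤ-cong N (λ i → ℤP.+-identityˡ (- block (suc i)))) (Σℤ-neg N (block ∘ suc)))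

    lap-block-∈ : ∀ p → InB (toℕ p) → + 1 ≤ lap W block (suc p)
    lap-block-∈ p p∈B = subst (+ 1 ≤_) (sym (lap-rim N block p))
      (subst (λ b → + 1 ≤ (b - + 0) + Σℤ N (λ w → + cycAdj N p w * (b - block (suc w)))) (sym (block-rim-∈ p∈B))
        (ℤP.i≤i+j (+ 1) _ {{ℤ.nonNegative (Σℤ-nonNeg N (λ w →
          scale-nonNeg (cycAdj N p w) (ℤP.i≤j⇒0≤j-i (indicator≤1 (does (inBlock? a k (toℕ w)))))))}}))

    lap-block-∉ : ∀ p → ¬ InB (toℕ p) → lap W block (suc p) ≡ - Σℤ N (λ w → + cycAdj N p w * block (suc w))
    lap-block-∉ p p∉B = begin
      lap W block (suc p)
        ≡⟨ lap-rim N block p ⟩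
      (block (suc p) - + 0) + Σℤ N (λ w → + cycAdj N p w * (block (suc p) - block (suc w)))
        ≡⟨ cong (λ b → (b - + 0) + Σℤ N (λ w → + cycAdj N p w * (b - block (suc w)))) (block-rim-∉ p∉B) ⟩
      + 0 + Σℤ N (λ w → + cycAdj N p w * (+ 0 - block (suc w)))
        ≡⟨ ℤP.+-identityˡ _ ⟩
      Σℤ N (λ w → + cycAdj N p w * (+ 0 - block (suc w)))
        ≡⟨ Σℤ-cong N (λ w → trans (cong (+ cycAdj N p w *_) (ℤP.+-identityˡ _))
                                  (sym (ℤP.neg-distribʳ-* (+ cycAdj N p w) (block (suc w))))) ⟩
      Σℤ N (λ w → - (+ cycAdj N p w * block (suc w)))
        ≡⟨ Σℤ-neg N (λ w → + cycAdj N p w * block (suc w)) ⟩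
      - Σℤ N (λ w → + cycAdj N p w * block (suc w)) ∎
      where open ≡-Reasoning

    -- The script −block moves one chip from the hub onto each block vertex; the rim vertices
    -- bordering the block are multiples of s and lose one chip per block neighbour.
    repaired : Divisor W
    repaired w = multiplesDivisor w - point W (suc u) 1 w + lap W block w

    repaired-equiv : Equiv W (subD W multiplesDivisor (point W (suc u) 1)) repaired
    repaired-equiv = (λ w → - block w) , λ w →
      trans (cancel (multiplesDivisor w) (point W (suc u) 1 w) (lap W block w)) (sym (lap-neg W block w))
      where
      cancel : ∀ d e l → d - e - (d - e + l) ≡ - l
      cancel = solve-∀

    repaired-effective : Effective W repaired
    repaired-effective zero = subst (λ l → + 0 ≤ + k - + 0 + l) (sym lap-block-hub)
      (subst (+ 0 ≤_) (cong (_- Σ< N (inBlock a k)) (sym (ℤP.+-identityʳ (+ k))))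
        (ℤP.i≤j⇒0≤j-i (Σ<-inBlock≤ a k N)))
    repaired-effective (suc p) = by-cases (inBlock? a k (toℕ p))
      where
      D = multiplesDivisor (suc p)
      e = point W (suc u) 1 (suc p)
      L = lap W block (suc p)
      by-cases : Dec (InB (toℕ p)) → + 0 ≤ D - e + L
      by-cases (yes p∈B) = subst (_≤ D - e + L) (ℤP.+-inverseˡ (+ 1))
        (ℤP.+-mono-≤ (ℤP.+-mono-≤ (multiplesDivisor-effective (suc p)) (ℤP.neg-mono-≤ e≤1)) (lap-block-∈ p p∈B))
        where
        e≤1 : e ≤ + 1
        e≤1 with does (suc u ≟ suc p)
        ... | true  = ℤP.≤-refl
        ... | false = +≤+ z≤n
      by-cases (no p∉B) = subst (λ x → + 0 ≤ x + L) D≡D-e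
        (subst (_≤ D + L) (ℤP.+-inverseʳ D) (ℤP.+-monoʳ-≤ D (subst (- D ≤_) (sym (lap-block-∉ p p∉B))
          (ℤP.neg-mono-≤ (ℤP.≤-trans
            (Σ-cycle-neighbours≤ p (block ∘ suc) (indicator-nonNeg ∘ does ∘ inBlock? a k ∘ toℕ))
            (block-neighbours≤ p p∉B))))))
        where
        D≡D-e : D ≡ D - e
        D≡D-e = trans (sym (ℤP.+-identityʳ D)) (cong (λ b → D - (if b then + 1 else + 0))
          (sym (dec-false (suc u ≟ suc p) (λ u≡p → p∉B (subst (InB ∘ toℕ) (FinP.suc-injective u≡p) u∈block)))))

  multiplesDivisor-rankOne : 1 ℕ.≤ k → RankOne W multiplesDivisor
  multiplesDivisor-rankOne 1≤k v with + 1 ℤ.≤? multiplesDivisor v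
  ... | yes chip = subD W multiplesDivisor (point W v 1) ,
                   subD-point-effective W v multiplesDivisor-effective chip ,
                   Equiv-refl W {subD W multiplesDivisor (point W v 1)}
  multiplesDivisor-rankOne 1≤k zero    | no ¬chip = ⊥-elim (¬chip (+≤+ 1≤k))
  multiplesDivisor-rankOne 1≤k (suc u) | no ¬chip =
    repaired u not-multiple , repaired-effective u not-multiple , repaired-equiv u not-multiple
    where
    not-multiple : toℕ u % s ≢ 0
    not-multiple multiple = ¬chip (ℤP.≤-reflexive (sym (indicator-yes (toℕ u % s ℕ.≟ 0) multiple)))

-- Lower bound

module _ (n′ : ℕ) where

  private
    N = suc n′
    W = wheel N

  _⊕_ : Fin N → ℕ → Fin N
  u ⊕ j = (toℕ u ℕ.+ j) mod N

  ⊕-identityʳ : ∀ u → u ⊕ 0 ≡ u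
  ⊕-identityʳ u = trans (cong (_mod N) (ℕP.+-identityʳ (toℕ u))) (toℕ-mod-id u)

  ChipWithinReach : Divisor W → Fin N → Set
  ChipWithinReach D u = (Σ ℕ λ j → + j ≤ D zero × + 1 ≤ D (suc (u ⊕ j))) ⊎ (+ N ≤ D zero)

  HubGrows : Divisor W → Set
  HubGrows D = Σ (Divisor W) λ D₂ → Effective W D₂ × Equiv W D D₂ × (D zero + + 1 ≤ D₂ zero)

  module _ (D D′ : Divisor W) (D′≥0 : Effective W D′) (z : Vertex W → ℤ)
           (D-D′≡Lz : ∀ v → D v - D′ v ≡ lap W z v) (m : Vertex W) (z≤zm : ∀ w → z w ≤ z m) where

    open MaxLevelSet W z m z≤zm

    hub∉U⇒HubGrows : Effective W D → inU zero ≡ false → HubGrows D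
    hub∉U⇒HubGrows D≥0 hub∉U =
      fire W D 𝟙U , fire-U-effective D D′ D′≥0 D-D′≡Lz D≥0 , Equiv-fire W D 𝟙U , hub-gains
      where
      X = Σℤ N (𝟙U ∘ suc)
      U-on-rim : ∀ x → inU x ≡ true → Σ (Fin N) λ i → x ≡ suc i
      U-on-rim zero    hub∈U = ⊥-elim (case trans (sym hub∈U) hub∉U of λ ())
      U-on-rim (suc i) _     = i , refl
      1≤X : + 1 ≤ X
      1≤X = let i , m≡i = U-on-rim m m∈U in
        subst (_≤ X) (trans (cong 𝟙U (sym m≡i)) (cong indicator m∈U))
          (term≤Σℤ N (indicator-nonNeg ∘ inU ∘ suc) i)
      lap-𝟙U-hub : lap W 𝟙U zero ≡ - X
      lap-𝟙U-hub = trans (lap-hub N 𝟙U) (trans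
        (Σℤ-cong N (λ i → trans (cong (λ h → indicator h - 𝟙U (suc i)) hub∉U) (ℤP.+-identityˡ (- 𝟙U (suc i)))))
        (Σℤ-neg N (𝟙U ∘ suc)))
      hub-gains : D zero + + 1 ≤ fire W D 𝟙U zero
      hub-gains = subst (D zero + + 1 ≤_)
        (trans (cong (_+_ (D zero)) (sym (ℤP.neg-involutive X))) (cong (_-_ (D zero)) (sym lap-𝟙U-hub)))
        (ℤP.+-monoʳ-≤ (D zero) 1≤X)

    missing : Fin N → ℤ
    missing i = indicator (not (inU (suc i)))

    Σmissing≤hub : inU zero ≡ true → Σℤ N missing ≤ D zero
    Σmissing≤hub hub∈U = ℤP.≤-trans (Σℤ-mono-≤ N termwise)
      (subst (_≤ D zero) (lap-hub N z) (lap-z≤D D D′ D′≥0 D-D′≡Lz zero))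
      where
      termwise : ∀ i → missing i ≤ z zero - z (suc i)
      termwise i rewrite inU-true hub∈U with inU (suc i) in i∈U
      ... | true  = ℤP.i≤j⇒0≤j-i (z≤zm (suc i))
      ... | false = inU-false i∈U

    chip-after-gap : ∀ p q → inU (suc p) ≡ true → inU (suc q) ≡ false → cycAdj N p q ≡ 1 →
      + 1 ≤ D (suc p)
    chip-after-gap p q p∈U q∉U p~q =
      ℤP.≤-trans 1≤lap (subst (_≤ D (suc p)) (lap-rim N z p) (lap-z≤D D D′ D′≥0 D-D′≡Lz (suc p)))
      where
      zp≡zm = inU-true p∈U
      term : Fin N → ℤ
      term w = + cycAdj N p w * (z (suc p) - z (suc w))
      term≥0 : ∀ w → + 0 ≤ term w
      term≥0 w rewrite zp≡zm = scale-nonNeg (cycAdj N p w) (ℤP.i≤j⇒0≤j-i (z≤zm (suc w)))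
      1≤term-q : + 1 ≤ term q
      1≤term-q rewrite p~q | zp≡zm = subst (+ 1 ≤_) (sym (ℤP.*-identityˡ _)) (inU-false q∉U)
      1≤lap : + 1 ≤ (z (suc p) - z zero) + Σℤ N term
      1≤lap = ℤP.i≤j⇒i≤k+j _ {{ℤ.nonNegative (ℤP.i≤j⇒0≤j-i (subst (z zero ≤_) (sym zp≡zm) (z≤zm zero)))}}
                (ℤP.≤-trans 1≤term-q (term≤Σℤ N term≥0 q))

    -- Walking clockwise from u ∉ U, the first vertex of U borders a vertex outside U and so holds
    -- a chip, while every vertex passed is outside U and costs the hub a chip.
    hub∈U⇒reach : ∀ u → inU zero ≡ true → inU (suc u) ≡ false → ChipWithinReach D u
    hub∈U⇒reach u hub∈U u∉U = reach (search-least at∈U N)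
      where
      at : ℕ → Fin N
      at = u ⊕_
      at∈U : ℕ → Bool
      at∈U = inU ∘ suc ∘ at
      gap≤hub : ∀ j → j ℕ.≤ N → (∀ i → i ℕ.< j → at∈U i ≡ false) → + j ≤ D zero
      gap≤hub j j≤N gap = begin
        + j                                        ≡⟨ sym (ℤP.*-identityʳ (+ j)) ⟩
        + j * + 1                                  ≡⟨ sym (Σℤ-const j (+ 1)) ⟩
        Σ< j (λ _ → + 1)
          ≡⟨ Σ<-cong j (λ i i<j → cong (indicator ∘ not) (sym (gap i i<j))) ⟩
        Σ< j (missing ∘ at)
          ≤⟨ Σ<-mono-length (indicator-nonNeg ∘ not ∘ inU ∘ suc ∘ at) j≤N ⟩
        Σ< N (missing ∘ at)
          ≡⟨ Σℤ-cong N (λ i → cong (missing ∘ (_mod N)) (ℕP.+-comm (toℕ u) (toℕ i))) ⟩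
        Σ< N (λ i → missing ((i ℕ.+ toℕ u) mod N)) ≡⟨ Σℤ-rotate N missing (toℕ u) ⟩
        Σℤ N missing                               ≤⟨ Σmissing≤hub hub∈U ⟩
        D zero                                     ∎
        where open ℤP.≤-Reasoning
      reach : LeastTrueBelow at∈U N ⊎ (∀ i → i ℕ.< N → at∈U i ≡ false) → ChipWithinReach D u
      reach (inj₁ (zero , _ , u∈U , _)) =
        ⊥-elim (case trans (sym u∈U) (trans (cong (inU ∘ suc) (⊕-identityʳ u)) u∉U) of λ ())
      reach (inj₁ (suc j , j<N , p∈U , gap)) =
        inj₁ (suc j , gap≤hub (suc j) (ℕP.<⇒≤ j<N) gap ,
              chip-after-gap (at (suc j)) (at j) p∈U (gap j ℕP.≤-refl) (cycAdj-succ _ _ p-follows-q))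
        where
        p-follows-q : toℕ (at (suc j)) ≡ suc (toℕ (at j)) % N
        p-follows-q = trans (cong (toℕ ∘ (_mod N)) (ℕP.+-suc (toℕ u) j)) (toℕ-suc-mod (toℕ u ℕ.+ j) N)
      reach (inj₂ no-U) = inj₂ (gap≤hub N ℕP.≤-refl no-U)

  reach-or-grow : ∀ {D} → Effective W D → RankOne W D → ∀ u → ChipWithinReach D u ⊎ HubGrows D
  reach-or-grow {D} D≥0 rank1 u with + 1 ℤ.≤? D (suc u)
  ... | yes chip = inj₁ (inj₁ (0 , D≥0 zero , subst (λ x → + 1 ≤ D (suc x)) (sym (⊕-identityʳ u)) chip))
  ... | no ¬chip with RankOne⇒chipAt W {D} rank1 (suc u)
  ...   | D′ , D′≥0 , gain , z , D-D′≡Lz with argmax N z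
  ...     | m , z≤zm with MaxLevelSet.inU W z m z≤zm zero in hub∈U?
  ...       | true  = inj₁ (hub∈U⇒reach D D′ D′≥0 z D-D′≡Lz m z≤zm u hub∈U? u∉U)
    where
    u∉U = MaxLevelSet.gain⇒∉U W z m z≤zm D D′ D′≥0 D-D′≡Lz (suc u)
            (ℤP.i<j⇒i≤pred[j] (ℤP.≰⇒> ¬chip)) gain
  ...       | false = inj₂ (hub∉U⇒HubGrows D D′ D′≥0 z D-D′≡Lz m z≤zm D≥0 hub∈U?)

  hub≤deg : ∀ {D} → Effective W D → D zero ≤ deg W D
  hub≤deg {D} D≥0 = ℤP.i≤i+j (D zero) _ {{ℤ.nonNegative (Σℤ-nonNeg N (D≥0 ∘ suc))}}

  Reduced : Divisor W → Set
  Reduced D = Σ (Divisor W) λ D₁ → Effective W D₁ × Equiv W D D₁ × (∀ u → ChipWithinReach D₁ u)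

  reduce : ∀ {D} → RankOne W D → ∀ fuel D₁ → Effective W D₁ → Equiv W D D₁ →
    deg W D + + 1 ≤ D₁ zero + + fuel → Reduced D
  reduce {D} rank1 zero D₁ D₁≥0 D~D₁ bound = ⊥-elim (ℤP.<-irrefl refl (ℤP.suc[i]≤j⇒i<j (begin
    + 1 + deg W D  ≡⟨ ℤP.+-comm (+ 1) (deg W D) ⟩
    deg W D + + 1  ≤⟨ bound ⟩
    D₁ zero + + 0  ≡⟨ ℤP.+-identityʳ (D₁ zero) ⟩
    D₁ zero        ≤⟨ hub≤deg D₁≥0 ⟩
    deg W D₁       ≡⟨ sym (deg-Equiv W (wheel-symmetric N) {D} {D₁} D~D₁) ⟩
    deg W D        ∎)))
    where open ℤP.≤-Reasoning
  reduce {D} rank1 (suc fuel) D₁ D₁≥0 D~D₁ bound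
    with all-or-some N (reach-or-grow {D₁} D₁≥0 (RankOne-Equiv W {D} {D₁} D~D₁ rank1))
  ... | inj₁ all-reach = D₁ , D₁≥0 , D~D₁ , all-reach
  ... | inj₂ (D₂ , D₂≥0 , D₁~D₂ , grows) =
    reduce {D} rank1 fuel D₂ D₂≥0 (Equiv-trans W {D} {D₁} {D₂} D~D₁ D₁~D₂)
      (ℤP.≤-trans bound (ℤP.≤-trans (ℤP.≤-reflexive (sym (ℤP.+-assoc (D₁ zero) (+ 1) (+ fuel))))
                                    (ℤP.+-monoˡ-≤ (+ fuel) grows)))

  -- The hub count of the representative grows at each step and never exceeds deg D.
  RankOne⇒Reduced : ∀ {D} → RankOne W D → Reduced D
  RankOne⇒Reduced {D} rank1 =
    let D₀ , D₀≥0 , _ , D~D₀ = RankOne⇒chipAt W {D} rank1 zero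
    in reduce {D} rank1 (suc ℤ.∣ deg W D ∣) D₀ D₀≥0 D~D₀
         (ℤP.≤-trans (ℤP.+-monoˡ-≤ (+ 1) (i≤+∣i∣ (deg W D)))
           (subst (_≤ D₀ zero + + suc ℤ.∣ deg W D ∣) (ℤP.+-comm (+ 1) (+ ℤ.∣ deg W D ∣))
             (ℤP.i≤j+i _ (D₀ zero) {{ℤ.nonNegative (D₀≥0 zero)}})))

  cyclic-windows-cover : ∀ (f : Fin N → ℤ) a → (∀ u → + 1 ≤ Σ< (suc a) (λ j → f (u ⊕ j))) →
    + N ≤ + suc a * Σℤ N f
  cyclic-windows-cover f a window≥1 = begin
    + N                                           ≡⟨ cong +_ (sym (ℕP.*-identityʳ N)) ⟩
    + N * + 1                                     ≡⟨ sym (Σℤ-const N (+ 1)) ⟩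
    Σℤ N (λ _ → + 1)                              ≤⟨ Σℤ-mono-≤ N window≥1 ⟩
    Σℤ N (λ u → Σ< (suc a) (λ j → f (u ⊕ j)))     ≡⟨ Σℤ-comm N (suc a) (λ u j → f (u ⊕ toℕ j)) ⟩
    Σ< (suc a) (λ j → Σ< N (λ i → f ((i ℕ.+ j) mod N))) ≡⟨ Σℤ-cong (suc a) (λ j → Σℤ-rotate N f (toℕ j)) ⟩
    Σ< (suc a) (λ _ → Σℤ N f)                     ≡⟨ Σℤ-const (suc a) (Σℤ N f) ⟩
    + suc a * Σℤ N f                              ∎
    where open ℤP.≤-Reasoning

  reach-everywhere⇒bound : ∀ {D} → Effective W D → (∀ u → ChipWithinReach D u) →
    Σ ℕ λ a → Σ ℕ λ c → N ℕ.≤ suc a ℕ.* c × + (a ℕ.+ c) ≤ deg W D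
  reach-everywhere⇒bound {D} D≥0 reach with all-or-some N reach
  ... | inj₂ N≤hub = 0 , N , ℕP.≤-reflexive (sym (ℕP.*-identityˡ N)) , ℤP.≤-trans N≤hub (hub≤deg D≥0)
  ... | inj₁ window = a , c , ℤP.drop‿+≤+ N≤[1+a]c , a+c≤deg
    where
    a = ℤ.∣ D zero ∣
    +a≡hub : + a ≡ D zero
    +a≡hub = ℤP.0≤i⇒+∣i∣≡i (D≥0 zero)
    chip : Fin N → ℤ
    chip u = indicator (does (+ 1 ℤ.≤? D (suc u)))
    chip-nonNeg : ∀ u → + 0 ≤ chip u
    chip-nonNeg u = indicator-nonNeg _
    chip≤D : ∀ u → chip u ≤ D (suc u)
    chip≤D u with + 1 ℤ.≤? D (suc u)
    ... | yes 1≤Du = 1≤Du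
    ... | no  _    = D≥0 (suc u)
    chip≡1 : ∀ u → + 1 ≤ D (suc u) → chip u ≡ + 1
    chip≡1 u 1≤Du with + 1 ℤ.≤? D (suc u)
    ... | yes _  = refl
    ... | no ¬1≤Du = ⊥-elim (¬1≤Du 1≤Du)
    c = ℤ.∣ Σℤ N chip ∣
    +c≡Σchip : + c ≡ Σℤ N chip
    +c≡Σchip = ℤP.0≤i⇒+∣i∣≡i (Σℤ-nonNeg N chip-nonNeg)
    window≥1 : ∀ u → + 1 ≤ Σ< (suc a) (λ j → chip (u ⊕ j))
    window≥1 u = let j , j≤hub , chip-at-j = window u in
      subst (_≤ Σ< (suc a) (λ j → chip (u ⊕ j))) (chip≡1 (u ⊕ j) chip-at-j)
        (term≤Σ< (λ i → chip-nonNeg (u ⊕ i)) (s≤s (ℤP.drop‿+≤+ (subst (+ j ≤_) (sym +a≡hub) j≤hub))))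
    N≤[1+a]c : + N ≤ + (suc a ℕ.* c)
    N≤[1+a]c = subst (+ N ≤_) (trans (cong (+ suc a *_) (sym +c≡Σchip)) (sym (ℤP.pos-* (suc a) c)))
                 (cyclic-windows-cover chip a window≥1)
    a+c≤deg : + (a ℕ.+ c) ≤ deg W D
    a+c≤deg = subst₂ (λ x y → x + y ≤ deg W D) (sym +a≡hub) (sym +c≡Σchip)
                (ℤP.+-monoʳ-≤ (D zero) (Σℤ-mono-≤ N chip≤D))

  gonality-lower-bound : ∀ k → IsCeilSqrt N (suc k) → ∀ D → PositiveRank W D →
    + (k ℕ.+ ceilDiv N k) ≤ deg W D
  gonality-lower-bound k sqrt D positive =
    let D₁ , D₁≥0 , D~D₁ , reach = RankOne⇒Reduced {D} (PositiveRank⇒RankOne W {D} positive)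
        a , c , N≤[1+a]c , a+c≤deg = reach-everywhere⇒bound {D₁} D₁≥0 reach
    in ℤP.≤-trans (+≤+ (ceilSqrt-minimises {N} {k} {a} {c} sqrt N≤[1+a]c))
                  (subst (+ (a ℕ.+ c) ≤_) (sym (deg-Equiv W (wheel-symmetric N) {D} {D₁} D~D₁)) a+c≤deg)

theorem5p2 : (n : ℕ) → 3 ℕ.≤ n → (k : ℕ) → IsCeilSqrt n (suc k) →
    IsGonality (wheel n) (+ (k ℕ.+ ceilDiv n k))
theorem5p2 (suc n′) 3≤n k sqrt =
  let 1≤k , s<n = ceilSqrt-bounds 3≤n sqrt
      D = multiplesDivisor n′ k s<n
  in (D , RankOne⇒PositiveRank (wheel (suc n′)) {D} (multiplesDivisor-rankOne n′ k s<n 1≤k) ,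
      deg-multiplesDivisor n′ k s<n) ,
     gonality-lower-bound n′ k sqrt
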